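{- Let $G=(\mathfrak{N},\mathfrak{T},\mathfrak{R},\mathfrak{S})$ be a context-free grammar, $\Sigma$ a set of characters, $(\textsl{Lex},\textsl{Sel})$ a local lexing with respect to $\mathfrak{T}$ and $\Sigma$, and $D\in\Sigma^*$. For all $k\in\{0,\ldots,|D|\}$ and all $u\in\{0,1,2,\ldots\}$: if $p,q\in\mathcal{P}_k^u$ and there is $n\in\{0,\ldots,|q|\}$ with $|\overline{p}|=|\overline{q_0\ldots q_{n-1}}|\le k$ and $[p\,q_n\ldots q_{|q|-1}]\in\mathcal{L}_{\text{prefix}}$, then $p\,q_n\ldots q_{|q|-1}\in\mathcal{P}_k^u$.
   Context: Notation: for a set $U$, $U^*$ is the set of finite sequences over $U$, $\varepsilon$ the empty sequence, juxtaposition is concatenation, $|\alpha|$ is the length and $\alpha_i$ ($0\le i<|\alpha|$) the $i$-th element. A context-free grammar $(\mathfrak{N},\mathfrak{T},\mathfrak{R},\mathfrak{S})$ has disjoint nonterminals $\mathfrak{N}$ and terminals $\mathfrak{T}$, rules $\mathfrak{R}\subseteq\mathfrak{N}\times(\mathfrak{N}\cup\mathfrak{T})^*$, start symbol $\mathfrak{S}$; $\overset{*}{\Rightarrow}$ is the reflexive transitive closure of one-step derivation. $\mathcal{L}_{\text{prefix}}=\{w\in\mathfrak{T}^*\mid \exists\alpha\in(\mathfrak{N}\cup\mathfrak{T})^*.\ \mathfrak{S}\overset{*}{\Rightarrow}w\alpha\}$. Tokens: a token is a pair $x=(t,c)\in\mathfrak{T}\times\Sigma^*$; write $[x]=t$,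 $\overline{x}=c$, and for a token sequence (path) $q=x_0\ldots x_r$, $[q]=[x_0]\ldots[x_r]$ and $\overline{q}=\overline{x_0}\ldots\overline{x_r}$. A local lexing is a pair $(\textsl{Lex},\textsl{Sel})$ where: $\textsl{Lex}$ assigns to each $t\in\mathfrak{T}$ a function $\textsl{Lex}(t)$ which, given $D\in\Sigma^*$ and $k\in\{0,\ldots,|D|\}$, returns a set of tokens of the form $(t,c)$ with $k+|c|\le|D|$ and $c_i=D_{k+i}$ for $0\le i\le |c|-1$; and $\textsl{Sel}$ takes token sets $A\subseteq B$ and returns a token set with $A\subseteq\textsl{Sel}(A,B)\subseteq B$. Local lexing semantics for input $D$: let $\operatorname{limit} f\, X=\bigcup_{n\ge0}f^n(X)$. Let $\mathcal{X}_k=\{x\in\mathfrak{T}\times\Sigma^*\mid x\in\textsl{Lex}([x])(D,k)\}$ and $\operatorname{Append}_k\,T\,P=P\cup\{pt\mid p\in P,\ |\overline{p}|=k,\ t\in T,\ [pt]\in\mathcal{L}_{\text{prefix}}\}$. Define recursively for $k\in\{0,\ldots,|D|\}$, $u\ge0$: $\mathcal{P}_0^0=\{\varepsilon\}$; $\mathcal{W}_k^u=\{x\in\mathcal{X}_k\mid\exists p\in\mathcal{P}_k^u.\ |\overline{p}|=k\wedge[px]\in\mathcal{L}_{\text{prefix}}\}$; $\mathcal{Z}_k^0=\emptyset$; $\mathcal{Z}_k^{u+1}=\textsl{Sel}(\mathcal{Z}_k^u,\mathcal{W}_k^u)$; $\mathcal{P}_k^{u+1}=\operatorname{limit}(\operatorname{Append}_k\,\mathcal{Z}_k^{u+1})\,\mathcal{P}_k^u$;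 $\mathcal{P}_k^\infty=\bigcup_{u}\mathcal{P}_k^u$; $\mathcal{P}_{k+1}^0=\mathcal{P}_k^\infty$. -}

module Defs where

open import Data.Nat using (ℕ; zero; suc; _+_; _≤_)
open import Data.List using (List; []; _∷_; _++_; map; length; drop; concatMap; [_])
open import Data.Product using (Σ; ∃; _×_; _,_; proj₁; proj₂)
open import Data.Sum using (_⊎_; inj₁; inj₂)
open import Data.Empty using (⊥)
open import Relation.Binary.PropositionalEquality using (_≡_)
open import Relation.Binary.Construct.Closure.ReflexiveTransitive using (Star)

-- A context-free grammar (𝔑, 𝔗, ℜ, 𝔖).
-- Nonterminals and terminals are disjoint because symbols are 𝔑 ⊎ 𝔗.
record Grammar : Set₁ where
  field
    𝔑 : Set
    𝔗 : Set
    ℜ : 𝔑 → List (𝔑 ⊎ 𝔗) → Set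
    𝔖 : 𝔑

module GrammarDefs (G : Grammar) where
  open Grammar G

  Sym : Set
  Sym = 𝔑 ⊎ 𝔗

  data _⇒_ : List Sym → List Sym → Set where
    step : ∀ (α₁ α₂ : List Sym) (A : 𝔑) (γ : List Sym) → ℜ A γ →
           (α₁ ++ inj₁ A ∷ α₂) ⇒ (α₁ ++ γ ++ α₂)

  _⇒*_ : List Sym → List Sym → Set
  _⇒*_ = Star _⇒_

  Lprefix : List 𝔗 → Set
  Lprefix w = ∃ λ (α : List Sym) → (inj₁ 𝔖 ∷ []) ⇒* (map inj₂ w ++ α)

SetOf : Set → Set₁
SetOf A = A → Set

_⊆_ : {A : Set} → SetOf A → SetOf A → Set
P ⊆ Q = ∀ x → P x → Q x

Token : Grammar → Set → Set
Token G Σc = Grammar.𝔗 G × List Σc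

record LocalLexing (G : Grammar) (Σc : Set) : Set₁ where
  open Grammar G
  field
    Lex : 𝔗 → List Σc → ℕ → SetOf (Token G Σc)
    -- for k ∈ {0..|D|}, Lex t D k contains only tokens (t , c) with
    -- k + |c| ≤ |D| and c_i = D_{k+i}, i.e. c is a prefix of drop k D
    Lex-tok : ∀ t D k → k ≤ length D → ∀ x → Lex t D k x →
              (proj₁ x ≡ t) × (∃ λ rest → drop k D ≡ proj₂ x ++ rest)
    Sel : SetOf (Token G Σc) → SetOf (Token G Σc) → SetOf (Token G Σc)
    Sel-lower : ∀ A B → A ⊆ B → A ⊆ Sel A B
    Sel-upper : ∀ A B → A ⊆ B → Sel A B ⊆ B

iter : {A : Set} → (SetOf A → SetOf A) → ℕ → SetOf A → SetOf A
iter f zero X = X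
iter f (suc n) X = f (iter f n X)

limit : {A : Set} → (SetOf A → SetOf A) → SetOf A → SetOf A
limit f X a = ∃ λ n → iter f n X a

module Semantics (G : Grammar) (Σc : Set) (LL : LocalLexing G Σc) (D : List Σc) where
  open Grammar G
  open GrammarDefs G public
  open LocalLexing LL

  Tok : Set
  Tok = Token G Σc

  Path : Set
  Path = List Tok

  ⟦_⟧ : Path → List 𝔗
  ⟦ q ⟧ = map proj₁ q

  ‾_ : Path → List Σc
  ‾ q = concatMap proj₂ q

  𝒳 : ℕ → SetOf Tok
  𝒳 k x = Lex (proj₁ x) D k x

  Append : ℕ → SetOf Tok → SetOf Path → SetOf Path
  Append k T P r = P r ⊎
    (∃ λ (p : Path) → ∃ λ (t : Tok) →
       P p × (length (‾ p) ≡ k) × T t × Lprefix ⟦ p ++ [ t ] ⟧ × (r ≡ p ++ [ t ]))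

  𝒲 : ℕ → SetOf Path → SetOf Tok
  𝒲 k P x = 𝒳 k x × (∃ λ (p : Path) → P p × (length (‾ p) ≡ k) × Lprefix ⟦ p ++ [ x ] ⟧)

  empty : {A : Set} → SetOf A
  empty _ = ⊥

  stage : ℕ → ℕ → SetOf Path × SetOf Tok
  stage zero zero = (λ p → p ≡ []) , empty
  stage (suc k) zero = (λ p → ∃ λ u → proj₁ (stage k u) p) , empty
  stage k (suc u) =
    let P = proj₁ (stage k u)
        Z = proj₂ (stage k u)
        Z' = Sel Z (𝒲 k P)
    in limit (Append k Z') P , Z'

  𝒫 : ℕ → ℕ → SetOf Path
  𝒫 k u = proj₁ (stage k u)

  𝒵 : ℕ → ℕ → SetOf Tok
  𝒵 k u = proj₂ (stage k u)

  𝒫∞ : ℕ → SetOf Path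
  𝒫∞ k p = ∃ λ u → 𝒫 k u p

-- A path r lies in 𝒫ₖᵘ exactly when [r] ∈ ℒ_prefix and every token x of r, starting at
-- character offset j, has been selected there: x ∈ 𝒵ⱼ^∞ if j < k, and x ∈ 𝒵ₖᵘ if j = k.
-- This description constrains each token only relative to its own offset, so it survives
-- replacing the prefix q₀…qₙ₋₁ of q by any p of the same character length.
module Submission where

open import Defs
open import Data.Nat using (ℕ; zero; suc; _+_; _≤_; _<_; _⊔_; _≤′_; ≤′-refl; ≤′-step)
open import Data.Nat.Properties
  using (+-assoc; +-identityʳ; m≤m+n; ≤-<-trans; <-irrefl; m<n⇒m<1+n; n<1+n; n≤1+n;
         m<1+n⇒m<n∨m≡n; m≤m⊔n; m≤n⊔m; ≤⇒≤′)
open import Data.List using (List; []; _∷_; _++_; _∷ʳ_; [_]; length; take; drop; map)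
open import Data.List.Properties using (map-++; ++-assoc; length-++; take++drop≡id)
open import Data.List.Reverse using (Reverse; []; _∶_∶ʳ_; reverseView)
open import Data.Product using (∃; _×_; _,_; proj₁; proj₂)
open import Data.Sum using (inj₁; inj₂)
open import Data.Empty using (⊥-elim)
open import Function using (_∘_)
open import Relation.Nullary using (¬_)
open import Relation.Binary.PropositionalEquality
  using (_≡_; refl; sym; trans; cong; subst; module ≡-Reasoning)

⊆-reflexive : {A : Set} {P Q : SetOf A} → P ≡ Q → P ⊆ Q
⊆-reflexive refl _ a = a

limit-⊆ : {A : Set} {f : SetOf A → SetOf A} {X S : SetOf A} →
  X ⊆ S → (∀ Y → Y ⊆ S → f Y ⊆ S) → limit f X ⊆ S
limit-⊆ {f = f} {X} {S} X⊆S f-preserves a (n , a∈fⁿX) = iter-⊆ n a a∈fⁿX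
  where
  iter-⊆ : ∀ n → iter f n X ⊆ S
  iter-⊆ zero    = X⊆S
  iter-⊆ (suc n) = f-preserves (iter f n X) (iter-⊆ n)

module Paths (G : Grammar) (Σc : Set) (LL : LocalLexing G Σc) (D : List Σc) where
  open Grammar G
  open Semantics G Σc LL D
  open LocalLexing LL

  Lprefix-++⁻ˡ : ∀ w v → Lprefix (w ++ v) → Lprefix w
  Lprefix-++⁻ˡ w v (α , 𝔖⇒*wvα) = map inj₂ v ++ α , subst ([ inj₁ 𝔖 ] ⇒*_) reassociate 𝔖⇒*wvα
    where
    open ≡-Reasoning
    reassociate : map inj₂ (w ++ v) ++ α ≡ map inj₂ w ++ (map inj₂ v ++ α)
    reassociate = begin
      map inj₂ (w ++ v) ++ α              ≡⟨ cong (_++ α) (map-++ inj₂ w v) ⟩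
      (map inj₂ w ++ map inj₂ v) ++ α     ≡⟨ ++-assoc (map inj₂ w) (map inj₂ v) α ⟩
      map inj₂ w ++ (map inj₂ v ++ α)     ∎

  Lprefix-⟦++⟧⁻ˡ : ∀ a b → Lprefix ⟦ a ++ b ⟧ → Lprefix ⟦ a ⟧
  Lprefix-⟦++⟧⁻ˡ a b = Lprefix-++⁻ˡ ⟦ a ⟧ ⟦ b ⟧ ∘ subst Lprefix (map-++ proj₁ a b)

  -- stage recurses on k before u, so these unfoldings hold by refl only once k is split.
  𝒫-suc : ∀ k u → 𝒫 k (suc u) ≡ limit (Append k (𝒵 k (suc u))) (𝒫 k u)
  𝒫-suc zero    u = refl
  𝒫-suc (suc k) u = refl

  𝒵-suc : ∀ k u → 𝒵 k (suc u) ≡ Sel (𝒵 k u) (𝒲 k (𝒫 k u))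
  𝒵-suc zero    u = refl
  𝒵-suc (suc k) u = refl

  𝒵-zero : ∀ k t → ¬ 𝒵 k zero t
  𝒵-zero zero    t ()
  𝒵-zero (suc k) t ()

  𝒫-⊆-suc : ∀ k u → 𝒫 k u ⊆ 𝒫 k (suc u)
  𝒫-⊆-suc k u r r∈𝒫 = ⊆-reflexive (sym (𝒫-suc k u)) r (0 , r∈𝒫)

  𝒫-∷ʳ : ∀ k u {p t} → 𝒫 k (suc u) p → length (‾ p) ≡ k → 𝒵 k (suc u) t →
         Lprefix ⟦ p ∷ʳ t ⟧ → 𝒫 k (suc u) (p ∷ʳ t)
  𝒫-∷ʳ k u {p} {t} p∈𝒫 |p|≡k t∈𝒵 l with ⊆-reflexive (𝒫-suc k u) p p∈𝒫
  ... | m , p∈Appendᵐ =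
    ⊆-reflexive (sym (𝒫-suc k u)) (p ∷ʳ t) (suc m , inj₂ (p , t , p∈Appendᵐ , |p|≡k , t∈𝒵 , l , refl))

  𝒲-mono : ∀ k {P P′ : SetOf Path} → P ⊆ P′ → 𝒲 k P ⊆ 𝒲 k P′
  𝒲-mono k P⊆P′ x (x∈𝒳 , p , p∈P , |p|≡k , l) = x∈𝒳 , p , P⊆P′ p p∈P , |p|≡k , l

  𝒵⊆𝒲 : ∀ k u → 𝒵 k u ⊆ 𝒲 k (𝒫 k u)
  𝒵⊆𝒲 k zero    t t∈𝒵 = ⊥-elim (𝒵-zero k t t∈𝒵)
  𝒵⊆𝒲 k (suc u) t t∈𝒵 =
    𝒲-mono k (𝒫-⊆-suc k u) t (Sel-upper _ _ (𝒵⊆𝒲 k u) t (⊆-reflexive (𝒵-suc k u) t t∈𝒵))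

  𝒵-⊆-suc : ∀ k u → 𝒵 k u ⊆ 𝒵 k (suc u)
  𝒵-⊆-suc k u t t∈𝒵 = ⊆-reflexive (sym (𝒵-suc k u)) t (Sel-lower _ _ (𝒵⊆𝒲 k u) t t∈𝒵)

  𝒵-mono : ∀ k {u v} → u ≤ v → 𝒵 k u ⊆ 𝒵 k v
  𝒵-mono k {u} = mono′ ∘ ≤⇒≤′
    where
    mono′ : ∀ {v} → u ≤′ v → 𝒵 k u ⊆ 𝒵 k v
    mono′ ≤′-refl           = λ _ t∈𝒵 → t∈𝒵
    mono′ (≤′-step u≤′v) t = 𝒵-⊆-suc k _ t ∘ mono′ u≤′v t

  𝒵∞ : ℕ → SetOf Tok
  𝒵∞ j t = ∃ λ v → 𝒵 j v t

  data Selected (k u : ℕ) : ℕ → Tok → Set where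
    earlier : ∀ {j t} → j < k → 𝒵∞ j t → Selected k u j t
    current : ∀ {j t} → j ≡ k → 𝒵 k u t → Selected k u j t

  Selected-mono : ∀ k {u v} → u ≤ v → ∀ {j t} → Selected k u j t → Selected k v j t
  Selected-mono k u≤v (earlier j<k t∈𝒵∞) = earlier j<k t∈𝒵∞
  Selected-mono k u≤v (current j≡k t∈𝒵) = current j≡k (𝒵-mono k u≤v _ t∈𝒵)

  Selected-earlier : ∀ {k u v j t} → j < k → Selected k u j t → Selected k v j t
  Selected-earlier _   (earlier j<k t∈𝒵∞) = earlier j<k t∈𝒵∞
  Selected-earlier j<k (current refl _)   = ⊥-elim (<-irrefl refl j<k)

  Selected-suc-zero : ∀ k {j t} → Selected (suc k) zero j t → ∃ λ v → Selected k v j t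
  Selected-suc-zero k (current _ ())
  Selected-suc-zero k (earlier j<1+k (w , t∈𝒵)) with m<1+n⇒m<n∨m≡n j<1+k
  ... | inj₁ j<k  = 0 , earlier j<k (w , t∈𝒵)
  ... | inj₂ refl = w , current refl t∈𝒵

  width : Path → ℕ
  width q = length (‾ q)

  +-width-∷ : ∀ j t q → j + width (t ∷ q) ≡ j + length (proj₂ t) + width q
  +-width-∷ j t q = trans (cong (j +_) (length-++ (proj₂ t))) (sym (+-assoc j _ (width q)))

  -- In AllAt Q j q, the path q starts at character offset j.
  data AllAt (Q : ℕ → Tok → Set) : ℕ → Path → Set where
    []  : ∀ {j} → AllAt Q j []
    _∷_ : ∀ {j t q} → Q j t → AllAt Q (j + length (proj₂ t)) q → AllAt Q j (t ∷ q)

  AllAt-map : ∀ {Q Q′ : ℕ → Tok → Set} → (∀ {j t} → Q j t → Q′ j t) →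
              ∀ {j q} → AllAt Q j q → AllAt Q′ j q
  AllAt-map f []       = []
  AllAt-map f (x ∷ xs) = f x ∷ AllAt-map f xs

  AllAt-map-below : ∀ {Q Q′ : ℕ → Tok → Set} {m} → (∀ {i t} → i < m → Q i t → Q′ i t) →
                    ∀ {j} q → j + width q < m → AllAt Q j q → AllAt Q′ j q
  AllAt-map-below f []      _     []       = []
  AllAt-map-below {m = m} f {j} (t ∷ q) bound (x ∷ xs) =
    f (≤-<-trans (m≤m+n j _) bound) x ∷ AllAt-map-below f q (subst (_< m) (+-width-∷ j t q) bound) xs

  AllAt-++⁺ : ∀ {Q j} a {b} → AllAt Q j a → AllAt Q (j + width a) b → AllAt Q j (a ++ b)
  AllAt-++⁺ {Q} {j} [] {b} [] xs = subst (λ i → AllAt Q i b) (+-identityʳ j) xs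
  AllAt-++⁺ {Q} {j} (t ∷ a) {b} (x ∷ xs) ys =
    x ∷ AllAt-++⁺ a xs (subst (λ i → AllAt Q i b) (+-width-∷ j t a) ys)

  AllAt-++⁻ : ∀ {Q j} a {b} → AllAt Q j (a ++ b) → AllAt Q j a × AllAt Q (j + width a) b
  AllAt-++⁻ {Q} {j} [] {b} xs = [] , subst (λ i → AllAt Q i b) (sym (+-identityʳ j)) xs
  AllAt-++⁻ {Q} {j} (t ∷ a) {b} (x ∷ xs) with AllAt-++⁻ a xs
  ... | before , after = x ∷ before , subst (λ i → AllAt Q i b) (sym (+-width-∷ j t a)) after

  -- A path is finite, so finitely many stages suffice for all its tokens.
  AllAt-∃⇒∃-AllAt : ∀ {Q : ℕ → ℕ → Tok → Set} →
    (∀ {v w} → v ≤ w → ∀ {j t} → Q v j t → Q w j t) →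
    ∀ {j q} → AllAt (λ i t → ∃ λ v → Q v i t) j q → ∃ λ v → AllAt (Q v) j q
  AllAt-∃⇒∃-AllAt mono [] = 0 , []
  AllAt-∃⇒∃-AllAt {Q} mono ((v , x) ∷ xs) with AllAt-∃⇒∃-AllAt {Q} mono xs
  ... | w , xs′ = v ⊔ w , mono (m≤m⊔n v w) x ∷ AllAt-map (mono (m≤n⊔m v w)) xs′

  𝒫-sound : ∀ k u → 𝒫 k u ⊆ AllAt (Selected k u) 0
  𝒫-sound zero    zero _ refl        = []
  𝒫-sound (suc k) zero r (v , r∈𝒫) = AllAt-map lift (𝒫-sound k v r r∈𝒫)
    where
    lift : ∀ {j t} → Selected k v j t → Selected (suc k) zero j t
    lift (earlier j<k t∈𝒵∞) = earlier (m<n⇒m<1+n j<k) t∈𝒵∞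
    lift (current refl t∈𝒵) = earlier (n<1+n k) (v , t∈𝒵)
  𝒫-sound k (suc u) r r∈𝒫 =
    limit-⊆ (λ r′ → AllAt-map (Selected-mono k (n≤1+n u)) ∘ 𝒫-sound k u r′)
            Append-preserves r (⊆-reflexive (𝒫-suc k u) r r∈𝒫)
    where
    Append-preserves : ∀ Y → Y ⊆ AllAt (Selected k (suc u)) 0 →
                       Append k (𝒵 k (suc u)) Y ⊆ AllAt (Selected k (suc u)) 0
    Append-preserves Y Y⊆ r (inj₁ r∈Y) = Y⊆ r r∈Y
    Append-preserves Y Y⊆ _ (inj₂ (p , t , p∈Y , |p|≡k , t∈𝒵 , _ , refl)) =
      AllAt-++⁺ p (Y⊆ p p∈Y) (current |p|≡k t∈𝒵 ∷ [])

  𝒫-complete : ∀ k u r → Lprefix ⟦ r ⟧ → AllAt (Selected k u) 0 r → 𝒫 k u r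
  𝒫-complete zero zero [] _ [] = refl
  𝒫-complete zero zero _  _ (earlier () _ ∷ _)
  𝒫-complete zero zero _  _ (current _ () ∷ _)
  𝒫-complete (suc k) zero r l sel
    with AllAt-∃⇒∃-AllAt {Selected k} (Selected-mono k) (AllAt-map (Selected-suc-zero k) sel)
  ... | v , sel′ = v , 𝒫-complete k v r l sel′
  𝒫-complete k (suc u) r = complete-from-end (reverseView r)
    where
    complete-from-end : ∀ {r} → Reverse r → Lprefix ⟦ r ⟧ → AllAt (Selected k (suc u)) 0 r →
                        𝒫 k (suc u) r
    complete-from-end [] l [] = 𝒫-⊆-suc k u [] (𝒫-complete k u [] l [])
    complete-from-end (r ∶ view ∶ʳ t) l sel with AllAt-++⁻ r sel
    ... | sel-r , earlier |r|<k t∈𝒵∞ ∷ [] =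
      𝒫-⊆-suc k u (r ∷ʳ t) (𝒫-complete k u (r ∷ʳ t) l
        (AllAt-++⁺ r (AllAt-map-below Selected-earlier r |r|<k sel-r) (earlier |r|<k t∈𝒵∞ ∷ [])))
    ... | sel-r , current |r|≡k t∈𝒵 ∷ [] =
      𝒫-∷ʳ k u (complete-from-end view (Lprefix-⟦++⟧⁻ˡ r [ t ] l) sel-r) |r|≡k t∈𝒵 l

theorem3 : (G : Grammar) (Σc : Set) (LL : LocalLexing G Σc) (D : List Σc) →
    let open Semantics G Σc LL D in
    ∀ (k : ℕ) → k ≤ length D → ∀ (u : ℕ) (p q : Path) →
    𝒫 k u p → 𝒫 k u q →
    ∀ (n : ℕ) → n ≤ length q →
    length (‾ p) ≡ length (‾ (take n q)) → length (‾ p) ≤ k →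
    Lprefix ⟦ p ++ drop n q ⟧ →
    𝒫 k u (p ++ drop n q)
theorem3 G Σc LL D k _ u p q p∈𝒫 q∈𝒫 n _ |p|≡|q↾n| _ l =
  𝒫-complete k u (p ++ drop n q) l (AllAt-++⁺ p (𝒫-sound k u p p∈𝒫) suffix-at-|p|)
  where
  open Paths G Σc LL D

  q-split : AllAt (Selected k u) 0 (take n q ++ drop n q)
  q-split = subst (AllAt (Selected k u) 0) (sym (take++drop≡id n q)) (𝒫-sound k u q q∈𝒫)

  suffix-at-|p| : AllAt (Selected k u) (width p) (drop n q)
  suffix-at-|p| = subst (λ j → AllAt (Selected k u) j (drop n q)) (sym |p|≡|q↾n|)
                        (proj₂ (AllAt-++⁻ (take n q) q-split))
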